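{- For every even integer $n \ge 6$, there exists an NFA with $n$ states over an alphabet of $3$ letters that admits a mortal word and whose shortest mortal word has length at least $2^{(n-4)/2}$.
   Context: An NFA (nondeterministic finite semi-automaton, with no initial or final states) is a triple $(Q, \Sigma, \Delta)$ where $Q$ is a finite set of states, $\Sigma$ is a finite alphabet, and $\Delta: Q \times \Sigma \to 2^Q$ is a transition relation; possibly $\Delta(q,a) = \emptyset$. Write $q \cdot a = \Delta(q,a)$, extend to words by $q \cdot \varepsilon = \{q\}$ and $q \cdot (wa) = \bigcup_{p \in q \cdot w} p \cdot a$, and to sets $S \subseteq Q$ by $S \cdot w = \bigcup_{q \in S} q \cdot w$. A word $w \in \Sigma^*$ is mortal for the NFA if $Q \cdot w = \emptyset$. The number of states is $|Q|$. -}

module Defs where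

open import Data.Nat using (ℕ)
open import Data.Fin using (Fin)
open import Data.Fin.Subset using (Subset; _∈_; ⊥; ⁅_⁆; ⊤; _∪_)
open import Data.Fin.Subset.Properties using (_∈?_)
open import Data.List using (List; []; _∷_; foldl; filter)
open import Data.List.Base using (allFin)
open import Relation.Binary.PropositionalEquality using (_≡_)

NFA : ℕ → ℕ → Set
NFA n k = Fin n → Fin k → Subset n

Word : ℕ → Set
Word k = List (Fin k)

⋃ : ∀ {n} → List (Subset n) → Subset n
⋃ [] = ⊥
⋃ (S ∷ Ss) = S ∪ ⋃ Ss

stepSet : ∀ {n k} → NFA n k → Subset n → Fin k → Subset n
stepSet {n} Δ S a = ⋃ (Data.List.map (λ q → Δ q a) (filter (λ q → q ∈? S) (allFin n)))

_·[_]_ : ∀ {n k} → Subset n → NFA n k → Word k → Subset n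
S ·[ Δ ] w = foldl (stepSet Δ) S w

Mortal : ∀ {n k} → NFA n k → Word k → Set
Mortal Δ w = ⊤ ·[ Δ ] w ≡ ⊥

module Submission where

-- The automaton runs a binary counter of k = m − 2 digits.  Its states are the cells (b , i)
-- of a cyclic register with positions 0 … k, a flag, and a hub leading to every state, and
-- each set reachable from Q either is Q or ∅ or holds one digit in every position but one
-- (the gap).  Letter rotate moves every digit one position on, the one at position k wrapping
-- to 0; toggle also complements the wrapping digit.  A wrapping digit raises the flag unless a
-- toggle turned it from 0 into 1, the wrapping gap lowers it, and a toggle with the flag up
-- leads to Q; so a pass of toggles through the trailing zeros and the lowest one, then
-- rotations, is a decrement.  Letter reset restarts at the counter 2^k − 1 and is the only way
-- to reach ∅, which it does exactly when the counter is 0 and the gap is at position k.  A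
-- potential equal to the counter value, with a running borrow undone, is 2^k on Q, 0 on ∅,
-- and drops by at most one per letter.

open import Defs
open import Data.Bool using (Bool; true; false; not; _∧_; _∨_; T; if_then_else_)
open import Data.Bool.Properties using (T-∧; T-∨; T-≡; ∨-assoc; ∨-comm) renaming (_≟_ to _≟ᵇ_)
open import Data.Empty using (⊥-elim)
open import Data.Maybe using (Maybe; just; nothing; maybe′)
import Data.Maybe as Maybe
open import Data.Maybe.Properties using () renaming (≡-dec to ≡-dec-Maybe)
open import Data.Nat using (ℕ; zero; suc; _+_; _*_; _^_; _∸_; _≤_; _<_; z≤n; s≤s; NonZero; ≢-nonZero⁻¹)
open import Data.Nat.Properties
open import Data.Nat.Tactic.RingSolver using (solve-∀)
open import Data.Fin using (Fin; zero; suc; toℕ; fromℕ; fromℕ<; inject₁; combine; remQuot)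
open import Data.Fin.Properties using (remQuot-combine; toℕ-fromℕ; toℕ-inject₁; toℕ<n; toℕ-fromℕ<) renaming (_≟_ to _≟ᶠ_)
open import Data.Fin.Subset using (Subset; ⊤; ⊥; _⊆_) renaming (_∈_ to _∈ˢ_)
open import Data.Fin.Subset.Properties using (_∈?_; x∈p∪q⁻; x∈p∪q⁺; ∉⊥; ∈⊤; ⊆-antisym; ⊆⊤; ⊥⊆)
open import Data.List using (List; []; _∷_; _++_; _∷ʳ_; [_]; length; map; foldl; filter; allFin; replicate; reverse; _ʳ++_)
open import Data.Bool.ListAction using (or)
open import Data.List.Properties using (length-ʳ++; length-reverse; reverse-involutive; length-replicate; foldl-++; length-++; length-map; map-++; ++-assoc; unfold-reverse)
open import Data.List.Membership.Propositional using () renaming (_∈_ to _∈ˡ_)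
open import Data.List.Membership.Propositional.Properties using (∈-filter⁺; ∈-filter⁻; ∈-allFin; ∈-map⁺; ∈-map⁻)
open import Data.List.Relation.Unary.Any using (here; there)
open import Data.Product using (Σ; ∃; ∃₂; _×_; _,_; proj₁; proj₂)
open import Data.Sum using (inj₁; inj₂)
open import Data.Vec using (tabulate)
open import Data.Vec.Properties using (lookup∘tabulate; lookup⇒[]=; []=⇒lookup)
open import Function using (_∘_; const; _⇔_; mk⇔)
open import Function.Bundles using (Equivalence)
open import Relation.Binary.PropositionalEquality hiding ([_])
open import Relation.Nullary using (¬_)
open import Relation.Nullary.Decidable using (⌊_⌋; toWitness; fromWitness; _×-dec_; T?)

∈-⋃⁻ : ∀ {n} (Ss : List (Subset n)) {x} → x ∈ˢ ⋃ Ss → ∃ λ S → S ∈ˡ Ss × x ∈ˢ S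
∈-⋃⁻ [] x∈ = ⊥-elim (∉⊥ x∈)
∈-⋃⁻ (S ∷ Ss) x∈ with x∈p∪q⁻ S (⋃ Ss) x∈
... | inj₁ x∈S = S , here refl , x∈S
... | inj₂ x∈⋃ with ∈-⋃⁻ Ss x∈⋃
...   | S′ , S′∈ , x∈S′ = S′ , there S′∈ , x∈S′

∈-⋃⁺ : ∀ {n} (Ss : List (Subset n)) {x S} → S ∈ˡ Ss → x ∈ˢ S → x ∈ˢ ⋃ Ss
∈-⋃⁺ (S ∷ Ss) (here refl) x∈S = x∈p∪q⁺ (inj₁ x∈S)
∈-⋃⁺ (S ∷ Ss) (there S∈) x∈S = x∈p∪q⁺ {p = S} (inj₂ (∈-⋃⁺ Ss S∈ x∈S))

module _ {n k} (Δ : NFA n k) where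

  private
    images : Subset n → Fin k → List (Subset n)
    images S a = map (λ q → Δ q a) (filter (_∈? S) (allFin n))

  ∈-stepSet⁻ : ∀ S a {x} → x ∈ˢ stepSet Δ S a → ∃ λ q → q ∈ˢ S × x ∈ˢ Δ q a
  ∈-stepSet⁻ S a x∈ with ∈-⋃⁻ (images S a) x∈
  ... | S′ , S′∈ , x∈S′ with ∈-map⁻ (λ q → Δ q a) S′∈
  ...   | q , q∈ , refl = q , proj₂ (∈-filter⁻ (_∈? S) {xs = allFin n} q∈) , x∈S′

  ∈-stepSet⁺ : ∀ S a {q x} → q ∈ˢ S → x ∈ˢ Δ q a → x ∈ˢ stepSet Δ S a
  ∈-stepSet⁺ S a {q} q∈ x∈ =
    ∈-⋃⁺ (images S a) (∈-map⁺ (λ q → Δ q a) (∈-filter⁺ (_∈? S) {xs = allFin n} (∈-allFin q) q∈)) x∈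

  stepSet-⊥ : ∀ a → stepSet Δ ⊥ a ≡ ⊥
  stepSet-⊥ a = ⊆-antisym (λ x∈ → ⊥-elim (∉⊥ (proj₁ (proj₂ (∈-stepSet⁻ ⊥ a x∈))))) ⊥⊆

module FromRelation {n a} {State : Set} (decode : Fin n → State) (encode : State → Fin n)
                 (decode-encode : ∀ s → decode (encode s) ≡ s)
                 (R : State → Fin a → State → Bool) where

  ⟦_⟧ : (State → Bool) → Subset n
  ⟦ P ⟧ = tabulate (P ∘ decode)

  Δ : NFA n a
  Δ q ℓ = ⟦ R (decode q) ℓ ⟧

  ∈⟦⟧⁻ : ∀ P {x} → x ∈ˢ ⟦ P ⟧ → T (P (decode x))
  ∈⟦⟧⁻ P {x} x∈ = subst T (lookup∘tabulate (P ∘ decode) x) (subst T (sym ([]=⇒lookup x∈)) _)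

  ∈⟦⟧⁺ : ∀ P {x} → T (P (decode x)) → x ∈ˢ ⟦ P ⟧
  ∈⟦⟧⁺ P {x} Px = lookup⇒[]= x ⟦ P ⟧ (trans (lookup∘tabulate (P ∘ decode) x) (Equivalence.to T-≡ Px))

  encode-∈⟦⟧ : ∀ P {s} → T (P s) → encode s ∈ˢ ⟦ P ⟧
  encode-∈⟦⟧ P {s} Ps = ∈⟦⟧⁺ P (subst (T ∘ P) (sym (decode-encode s)) Ps)

  ⟦⟧-nonempty : ∀ P {s} → T (P s) → ⟦ P ⟧ ≢ ⊥
  ⟦⟧-nonempty P Ps ⟦P⟧≡⊥ = ∉⊥ (subst (_ ∈ˢ_) ⟦P⟧≡⊥ (encode-∈⟦⟧ P Ps))

  ⟦const-true⟧ : ⟦ const true ⟧ ≡ ⊤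
  ⟦const-true⟧ = ⊆-antisym ⊆⊤ (λ _ → ∈⟦⟧⁺ (const true) _)

  ⟦const-false⟧ : ⟦ const false ⟧ ≡ ⊥
  ⟦const-false⟧ = ⊆-antisym (λ x∈ → ⊥-elim (∈⟦⟧⁻ (const false) x∈)) ⊥⊆

  stepSet-⟦⟧ : ∀ P Q ℓ →
    (∀ s t → T (P s) → T (R s ℓ t) → T (Q t)) →
    (∀ t → T (Q t) → ∃ λ s → T (P s) × T (R s ℓ t)) →
    stepSet Δ ⟦ P ⟧ ℓ ≡ ⟦ Q ⟧
  stepSet-⟦⟧ P Q ℓ sound complete = ⊆-antisym ⊆Q Q⊆
    where
    ⊆Q : stepSet Δ ⟦ P ⟧ ℓ ⊆ ⟦ Q ⟧
    ⊆Q x∈ with ∈-stepSet⁻ Δ ⟦ P ⟧ ℓ x∈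
    ... | q , q∈ , x∈Δq = ∈⟦⟧⁺ Q (sound _ _ (∈⟦⟧⁻ P q∈) (∈⟦⟧⁻ (R (decode q) ℓ) x∈Δq))
    Q⊆ : ⟦ Q ⟧ ⊆ stepSet Δ ⟦ P ⟧ ℓ
    Q⊆ {x} x∈ with complete (decode x) (∈⟦⟧⁻ Q x∈)
    ... | s , Ps , Rst = ∈-stepSet⁺ Δ ⟦ P ⟧ ℓ (encode-∈⟦⟧ P Ps)
                           (∈⟦⟧⁺ (R (decode (encode s)) ℓ) (subst (λ s′ → T (R s′ ℓ (decode x))) (sym (decode-encode s)) Rst))

pattern rotate = zero
pattern toggle = suc zero
pattern reset  = suc (suc zero)

bit : Bool → ℕ
bit false = 0
bit true  = 1

m*[2*n]≡2*m*n : ∀ m n → m * (2 * n) ≡ 2 * m * n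
m*[2*n]≡2*m*n = solve-∀

value : List Bool → ℕ
value []       = 0
value (b ∷ bs) = bit b + 2 * value bs

value<2^length : ∀ bs → value bs < 2 ^ length bs
value<2^length []       = s≤s z≤n
value<2^length (b ∷ bs) = begin
  suc (bit b + 2 * value bs) ≤⟨ s≤s (+-monoˡ-≤ (2 * value bs) (bit≤1 b)) ⟩
  2 + 2 * value bs           ≡⟨ *-suc 2 (value bs) ⟨
  2 * suc (value bs)         ≤⟨ *-monoʳ-≤ 2 (value<2^length bs) ⟩
  2 * 2 ^ length bs          ∎
  where
  bit≤1 : ∀ b → bit b ≤ 1
  bit≤1 false = z≤n
  bit≤1 true  = s≤s z≤n
  open ≤-Reasoning

ones : ℕ → List Bool
ones j = replicate j true

suc-value-ones-ʳ++ : ∀ j bs → suc (value (ones j ʳ++ bs)) ≡ 2 ^ j * suc (value bs)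
suc-value-ones-ʳ++ zero    bs = sym (*-identityˡ _)
suc-value-ones-ʳ++ (suc j) bs = trans (suc-value-ones-ʳ++ j (true ∷ bs)) (double (2 ^ j) (value bs))
  where
  double : ∀ p v → p * (2 + 2 * v) ≡ 2 * p * (1 + v)
  double = solve-∀

suc-value-ones : ∀ j → suc (value (reverse (ones j))) ≡ 2 ^ j
suc-value-ones j = trans (suc-value-ones-ʳ++ j []) (*-identityʳ (2 ^ j))

value-zeros-ʳ++ : ∀ xs ys → or xs ≡ false → value (xs ʳ++ ys) ≡ 2 ^ length xs * value ys
value-zeros-ʳ++ []           ys _ = sym (*-identityˡ _)
value-zeros-ʳ++ (false ∷ xs) ys z = trans (value-zeros-ʳ++ xs (false ∷ ys) z) (m*[2*n]≡2*m*n (2 ^ length xs) (value ys))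

or-ʳ++ : ∀ xs ys → or (xs ʳ++ ys) ≡ or xs ∨ or ys
or-ʳ++ []       ys = refl
or-ʳ++ (x ∷ xs) ys =
  trans (or-ʳ++ xs (x ∷ ys)) (trans (sym (∨-assoc (or xs) x (or ys))) (cong (_∨ or ys) (∨-comm (or xs) x)))

decrement : List Bool → List Bool
decrement []           = []
decrement (false ∷ bs) = true ∷ decrement bs
decrement (true ∷ bs)  = false ∷ bs

length-decrement : ∀ bs → length (decrement bs) ≡ length bs
length-decrement []           = refl
length-decrement (false ∷ bs) = cong suc (length-decrement bs)
length-decrement (true ∷ bs)  = refl

suc-value-decrement : ∀ bs → or bs ≡ true → suc (value (decrement bs)) ≡ value bs
suc-value-decrement (false ∷ bs) nz = trans (sym (*-suc 2 _)) (cong (2 *_) (suc-value-decrement bs nz))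
suc-value-decrement (true ∷ bs)  _  = refl

module Counter (k : ℕ) where

  -- The digits of settled lo hi and borrowing j hi, least significant first, are lo ʳ++ hi
  -- and ones j ʳ++ hi; hi is still to wrap around, head first.  The flag is up in settled
  -- configurations; in borrowing j hi the j wrapped ones are a borrow still running.
  data Config : Set where
    full empty : Config
    settled    : (lo hi : List Bool) → Config
    borrowing  : (j : ℕ) (hi : List Bool) → Config

  next : Config → Fin 3 → Config
  next full  reset = borrowing k []
  next full  _     = full
  next empty _     = empty
  next (settled lo hi)       toggle = full
  next (settled lo (h ∷ hi)) rotate = settled (h ∷ lo) hi
  next (settled lo [])       rotate = borrowing 0 (reverse lo)
  next (settled lo (_ ∷ _))  reset  = borrowing k []
  next (settled lo [])       reset  = if or lo then borrowing k [] else empty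
  next (borrowing j hi)           reset  = borrowing k []
  next (borrowing j (h ∷ hi))     rotate = settled (h ∷ ones j) hi
  next (borrowing j [])           rotate = borrowing 0 (reverse (ones j))
  next (borrowing j (false ∷ hi)) toggle = borrowing (suc j) hi
  next (borrowing j (true ∷ hi))  toggle = settled (false ∷ ones j) hi
  next (borrowing j [])           toggle = borrowing 0 (reverse (ones j))

  run : Config → Word 3 → Config
  run = foldl next

  data Sized : Config → Set where
    full      : Sized full
    empty     : Sized empty
    settled   : ∀ {lo hi} → length lo + length hi ≡ k → Sized (settled lo hi)
    borrowing : ∀ {j hi} → j + length hi ≡ k → Sized (borrowing j hi)

  initial-sized : Sized (borrowing k [])
  initial-sized = borrowing (+-identityʳ k)

  sized-ones : ∀ j {n} → j + n ≡ k → length (ones j) + n ≡ k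
  sized-ones j {n} e = trans (cong (_+ n) (length-replicate j)) e

  private
    head-moved : ∀ {a b} → a + suc b ≡ k → suc a + b ≡ k
    head-moved {a} {b} = trans (sym (+-suc a b))

    gap-moved : ∀ lo → length lo + 0 ≡ k → Sized (borrowing 0 (reverse lo))
    gap-moved lo e = borrowing (trans (length-reverse lo) (trans (sym (+-identityʳ (length lo))) e))

  next-sized : ∀ {c} ℓ → Sized c → Sized (next c ℓ)
  next-sized reset  full  = initial-sized
  next-sized rotate full  = full
  next-sized toggle full  = full
  next-sized ℓ      empty = empty
  next-sized                       toggle (settled _) = full
  next-sized {settled lo (_ ∷ _)}  rotate (settled e) = settled (head-moved e)
  next-sized {settled lo []}       rotate (settled e) = gap-moved lo e
  next-sized {settled lo (_ ∷ _)}  reset  (settled _) = initial-sized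
  next-sized {settled lo []}       reset  (settled _) with or lo
  ... | true  = initial-sized
  ... | false = empty
  next-sized                        reset  (borrowing _) = initial-sized
  next-sized {borrowing j (_ ∷ _)}     rotate (borrowing e) = settled (head-moved (sized-ones j e))
  next-sized {borrowing j []}          rotate (borrowing e) = gap-moved (ones j) (sized-ones j e)
  next-sized {borrowing j (false ∷ _)} toggle (borrowing e) = borrowing (head-moved e)
  next-sized {borrowing j (true ∷ _)}  toggle (borrowing e) = settled (head-moved (sized-ones j e))
  next-sized {borrowing j []}          toggle (borrowing e) = gap-moved (ones j) (sized-ones j e)

  -- A running borrow is charged the value the counter had before it started; one that ran
  -- off the top has wrapped the counter around to 2^j − 1.
  potential : Config → ℕ
  potential full                   = 2 ^ k
  potential empty                  = 0
  potential (settled lo hi)        = value (lo ʳ++ hi)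
  potential (borrowing j [])       = value (reverse (ones j))
  potential (borrowing j (h ∷ hi)) = 2 ^ j * value (h ∷ hi)

  potential-borrowing-0 : ∀ hi → potential (borrowing 0 hi) ≡ value hi
  potential-borrowing-0 []       = refl
  potential-borrowing-0 (h ∷ hi) = *-identityˡ _

  suc-potential-initial : suc (potential (borrowing k [])) ≡ 2 ^ k
  suc-potential-initial = suc-value-ones k

  potential≤2^k : ∀ {c} → Sized c → potential c ≤ 2 ^ k
  potential≤2^k full  = ≤-refl
  potential≤2^k empty = z≤n
  potential≤2^k {settled lo hi} (settled e) =
    <⇒≤ (subst (λ n → value (lo ʳ++ hi) < 2 ^ n) (trans (length-ʳ++ lo) e) (value<2^length (lo ʳ++ hi)))
  potential≤2^k {borrowing j []} (borrowing e) =
    ≤-trans (n≤1+n _) (≤-reflexive (trans (suc-value-ones j) (cong (2 ^_) (trans (sym (+-identityʳ j)) e))))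
  potential≤2^k {borrowing j (h ∷ hi)} (borrowing e) =
    subst (2 ^ j * value (h ∷ hi) ≤_) (trans (sym (^-distribˡ-+-* 2 j (length (h ∷ hi)))) (cong (2 ^_) e))
      (*-monoʳ-≤ (2 ^ j) (<⇒≤ (value<2^length (h ∷ hi))))

  potential≤initial : ∀ {c} → Sized c → potential c ≤ suc (potential (borrowing k []))
  potential≤initial s = ≤-trans (potential≤2^k s) (≤-reflexive (sym suc-potential-initial))

  potential-next : ∀ {c} ℓ → Sized c → potential c ≤ suc (potential (next c ℓ))
  potential-next reset  full  = potential≤initial full
  potential-next rotate full  = n≤1+n _
  potential-next toggle full  = n≤1+n _
  potential-next ℓ      empty = z≤n
  potential-next                       toggle s@(settled _) = m≤n⇒m≤1+n (potential≤2^k s)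
  potential-next {settled lo (_ ∷ _)}  rotate (settled _)   = n≤1+n _
  potential-next {settled lo []}       rotate (settled _)   =
    m≤n⇒m≤1+n (≤-reflexive (sym (potential-borrowing-0 (reverse lo))))
  potential-next {settled lo (_ ∷ _)}  reset  s@(settled _) = potential≤initial s
  potential-next {settled lo []}       reset  s@(settled _) with or lo in some-one
  ... | true  = potential≤initial s
  ... | false = ≤-trans (≤-reflexive (trans (value-zeros-ʳ++ lo [] some-one) (*-zeroʳ (2 ^ length lo)))) z≤n
  potential-next                        reset  s@(borrowing _) = potential≤initial s
  potential-next {borrowing j (h ∷ hi)} rotate (borrowing _)   =
    ≤-trans (*-monoʳ-≤ (2 ^ j) (n≤1+n _)) (≤-reflexive (sym (suc-value-ones-ʳ++ j (h ∷ hi))))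
  potential-next {borrowing j []}       rotate (borrowing _)   =
    m≤n⇒m≤1+n (≤-reflexive (sym (potential-borrowing-0 (reverse (ones j)))))
  potential-next {borrowing j []}       toggle (borrowing _)   =
    m≤n⇒m≤1+n (≤-reflexive (sym (potential-borrowing-0 (reverse (ones j)))))
  potential-next {borrowing j (true ∷ hi)}      toggle (borrowing _) = ≤-reflexive (sym (suc-value-ones-ʳ++ j (false ∷ hi)))
  potential-next {borrowing j (false ∷ [])}     toggle (borrowing _) = ≤-trans (≤-reflexive (*-zeroʳ (2 ^ j))) z≤n
  potential-next {borrowing j (false ∷ h ∷ hi)} toggle (borrowing _) =
    m≤n⇒m≤1+n (≤-reflexive (m*[2*n]≡2*m*n (2 ^ j) (value (h ∷ hi))))

  run-sized : ∀ {c} w → Sized c → Sized (run c w)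
  run-sized []      s = s
  run-sized (ℓ ∷ w) s = run-sized w (next-sized ℓ s)

  potential≤length : ∀ {c} w → Sized c → run c w ≡ empty → potential c ≤ length w
  potential≤length []      _ refl = z≤n
  potential≤length (ℓ ∷ w) s dies = ≤-trans (potential-next ℓ s) (s≤s (potential≤length w (next-sized ℓ s) dies))

  run-rotations : ∀ lo hi → run (settled lo hi) (replicate (length hi) rotate) ≡ settled (hi ʳ++ lo) []
  run-rotations lo []       = refl
  run-rotations lo (h ∷ hi) = run-rotations (h ∷ lo) hi

  borrowWord : List Bool → Word 3
  borrowWord []           = []
  borrowWord (false ∷ bs) = toggle ∷ borrowWord bs
  borrowWord (true ∷ bs)  = toggle ∷ replicate (length bs) rotate

  run-borrowWord : ∀ j bs → or bs ≡ true → run (borrowing j bs) (borrowWord bs) ≡ settled (decrement bs ʳ++ ones j) []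
  run-borrowWord j (false ∷ bs) nz = run-borrowWord (suc j) bs nz
  run-borrowWord j (true ∷ bs)  _  = run-rotations (false ∷ ones j) bs

  run-++ : ∀ c u v → run c (u ++ v) ≡ run (run c u) v
  run-++ = foldl-++ next

  reset-kills : ∀ lo → or lo ≡ false → next (settled lo []) reset ≡ empty
  reset-kills lo none rewrite none = refl

  mortal-from-zero : .{{NonZero k}} → ∀ hi → length hi ≡ k → or hi ≡ false →
                     ∃ λ w → run (borrowing 0 hi) w ≡ empty
  mortal-from-zero []       len _    = ⊥-elim (≢-nonZero⁻¹ k (sym len))
  mortal-from-zero (h ∷ hi) _   none = rotate ∷ rotations ∷ʳ reset , (begin
    run (settled [ h ] hi) (rotations ∷ʳ reset)      ≡⟨ run-++ _ rotations [ reset ] ⟩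
    next (run (settled [ h ] hi) rotations) reset     ≡⟨ cong (λ c → next c reset) (run-rotations [ h ] hi) ⟩
    next (settled (hi ʳ++ [ h ]) []) reset            ≡⟨ reset-kills (hi ʳ++ [ h ]) (trans (or-ʳ++ (h ∷ hi) []) (cong (_∨ false) none)) ⟩
    empty                                             ∎)
    where
    rotations : Word 3
    rotations = replicate (length hi) rotate
    open ≡-Reasoning

  mortal-from-borrowing : .{{NonZero k}} → ∀ n hi → length hi ≡ k → value hi ≡ n →
                          ∃ λ w → run (borrowing 0 hi) w ≡ empty
  mortal-from-borrowing n hi len val with or hi in nz
  ... | false = mortal-from-zero hi len nz
  mortal-from-borrowing zero hi len val | true = ⊥-elim (0≢1+n (trans (sym val) (sym (suc-value-decrement hi nz))))
  mortal-from-borrowing (suc n) hi len val | true with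
    mortal-from-borrowing n (decrement hi) (trans (length-decrement hi) len) (suc-injective (trans (suc-value-decrement hi nz) val))
  ... | w , dies = borrowWord hi ++ rotate ∷ w , (begin
    run (borrowing 0 hi) (borrowWord hi ++ rotate ∷ w)       ≡⟨ run-++ _ (borrowWord hi) (rotate ∷ w) ⟩
    run (run (borrowing 0 hi) (borrowWord hi)) (rotate ∷ w)   ≡⟨ cong (λ c → run c (rotate ∷ w)) (run-borrowWord 0 hi nz) ⟩
    run (borrowing 0 (reverse (reverse (decrement hi)))) w    ≡⟨ cong (λ bs → run (borrowing 0 bs) w) (reverse-involutive (decrement hi)) ⟩
    run (borrowing 0 (decrement hi)) w                        ≡⟨ dies ⟩
    empty                                                     ∎)
    where open ≡-Reasoning

  mortal-from-full : .{{NonZero k}} → ∃ λ w → run full w ≡ empty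
  mortal-from-full with mortal-from-borrowing _ (reverse (ones k)) (trans (length-reverse (ones k)) (length-replicate k)) refl
  ... | w , dies = reset ∷ rotate ∷ w , dies

slot : List (Maybe Bool) → ℕ → Maybe Bool
slot []       _       = nothing
slot (x ∷ _)  zero    = x
slot (_ ∷ xs) (suc n) = slot xs n

slot-∷ʳ-length : ∀ u h → slot (u ∷ʳ h) (length u) ≡ h
slot-∷ʳ-length []      h = refl
slot-∷ʳ-length (_ ∷ u) h = slot-∷ʳ-length u h

slot-∷ʳ-< : ∀ u h {n} → n < length u → slot (u ∷ʳ h) n ≡ slot u n
slot-∷ʳ-< (_ ∷ u) h {zero}  _         = refl
slot-∷ʳ-< (_ ∷ u) h {suc n} (s≤s n<) = slot-∷ʳ-< u h n<

slot-or : ∀ lo rest → or lo ≡ true → ∃ λ n → n < length lo × slot (map just lo ++ rest) n ≡ just true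
slot-or (true ∷ lo)  rest _  = 0 , s≤s z≤n , refl
slot-or (false ∷ lo) rest nz with slot-or lo rest nz
... | n , n< , held = suc n , s≤s n< , held

slot-¬or : ∀ lo → or lo ≡ false → ∀ n → slot (map just lo ∷ʳ nothing) n ≢ just true
slot-¬or []           _    zero    ()
slot-¬or []           _    (suc _) ()
slot-¬or (false ∷ lo) _    zero    ()
slot-¬or (false ∷ lo) none (suc n) = slot-¬or lo none n

module CounterNFA (k : ℕ) {{_ : NonZero k}} where

  open Counter k

  data State : Set where
    cell     : Bool → Fin (suc k) → State
    flag hub : State

  private
    width : ℕ
    width = suc (suc k)

    position : State → Fin 2 × Fin width
    position flag             = zero , zero
    position hub              = suc zero , zero
    position (cell true i)    = zero , suc i
    position (cell false i)   = suc zero , suc i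

    fromPosition : Fin 2 × Fin width → State
    fromPosition (zero , zero)       = flag
    fromPosition (suc zero , zero)   = hub
    fromPosition (zero , suc i)      = cell true i
    fromPosition (suc zero , suc i)  = cell false i

    fromPosition-position : ∀ s → fromPosition (position s) ≡ s
    fromPosition-position flag           = refl
    fromPosition-position hub            = refl
    fromPosition-position (cell true i)  = refl
    fromPosition-position (cell false i) = refl

  decode : Fin (2 * width) → State
  decode = fromPosition ∘ remQuot width

  encode : State → Fin (2 * width)
  encode s = combine (proj₁ (position s)) (proj₂ (position s))

  decode-encode : ∀ s → decode (encode s) ≡ s
  decode-encode s = trans (cong fromPosition (remQuot-combine _ _)) (fromPosition-position s)

  last : Fin (suc k)
  last = fromℕ k

  carried : Fin 3 → Bool → Bool
  carried toggle b = not b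
  carried _      b = b

  raisesFlag : Fin 3 → Bool → Bool
  raisesFlag toggle b = b
  raisesFlag _      _ = true

  cellMove : Fin 3 → Bool → Fin (suc k) → State → Bool
  cellMove ℓ b i (cell c zero)     = ⌊ i ≟ᶠ last ×-dec carried ℓ b ≟ᵇ c ⌋
  cellMove ℓ b i (cell c (suc i′)) = ⌊ i ≟ᶠ inject₁ i′ ×-dec b ≟ᵇ c ⌋
  cellMove ℓ b i flag              = ⌊ i ≟ᶠ last ×-dec T? (raisesFlag ℓ b) ⌋
  cellMove ℓ b i hub               = false

  survives : State → Bool
  survives (cell b i) = b ∨ ⌊ i ≟ᶠ last ⌋
  survives flag       = false
  survives hub        = true

  register : List (Maybe Bool) → Bool → State → Bool
  register u f (cell b i) = ⌊ ≡-dec-Maybe _≟ᵇ_ (slot u (toℕ i)) (just b) ⌋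
  register u f flag       = f
  register u f hub        = false

  -- Positions 0 … k hold lo (last wrapped digit first), the gap, then hi reversed, so that
  -- the head of hi is at position k.
  layout : List Bool → List Bool → List (Maybe Bool)
  layout lo hi = map just lo ++ nothing ∷ map just (reverse hi)

  initial : State → Bool
  initial = register (layout (ones k) []) false

  transition : State → Fin 3 → State → Bool
  transition s          reset  t = survives s ∧ initial t
  transition (cell b i) ℓ      t = cellMove ℓ b i t
  transition flag       rotate _ = false
  transition flag       toggle _ = true
  transition hub        _      _ = true

  open FromRelation decode encode decode-encode transition public

  ⟪_⟫ : Config → Subset (2 * width)
  ⟪ full ⟫          = ⊤
  ⟪ empty ⟫         = ⊥
  ⟪ settled lo hi ⟫ = ⟦ register (layout lo hi) true ⟧
  ⟪ borrowing j hi ⟫ = ⟦ register (layout (ones j) hi) false ⟧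

  afterShift : Fin 3 → List (Maybe Bool) → Maybe Bool → State → Bool
  afterShift ℓ u h = register (Maybe.map (carried ℓ) h ∷ u) (maybe′ (raisesFlag ℓ) false h)

  module _ (u : List (Maybe Bool)) (len : length u ≡ k) where

    slot-last : ∀ h → slot (u ∷ʳ h) (toℕ last) ≡ h
    slot-last h = trans (cong (slot (u ∷ʳ h)) (trans (toℕ-fromℕ k) (sym len))) (slot-∷ʳ-length u h)

    slot-inject₁ : ∀ h i → slot (u ∷ʳ h) (toℕ (inject₁ i)) ≡ slot u (toℕ i)
    slot-inject₁ h i =
      trans (cong (slot (u ∷ʳ h)) (toℕ-inject₁ i)) (slot-∷ʳ-< u h (subst (toℕ i <_) (sym len) (toℕ<n i)))

    cellMove-sound : ∀ {h f} ℓ {b i} t → T (register (u ∷ʳ h) f (cell b i)) → T (cellMove ℓ b i t) →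
                     T (afterShift ℓ u h t)
    cellMove-sound {h} ℓ (cell c zero) held move with toWitness move
    ... | refl , refl with trans (sym (slot-last h)) (toWitness held)
    ...   | refl = fromWitness refl
    cellMove-sound {h} ℓ (cell c (suc i′)) held move with toWitness move
    ... | refl , refl = fromWitness (trans (sym (slot-inject₁ h i′)) (toWitness held))
    cellMove-sound {h} ℓ flag held move with toWitness move
    ... | refl , raises with trans (sym (slot-last h)) (toWitness held)
    ...   | refl = raises

    cellMove-complete : ∀ {h f} ℓ t → T (afterShift ℓ u h t) →
                        ∃₂ λ b i → T (register (u ∷ʳ h) f (cell b i)) × T (cellMove ℓ b i t)
    cellMove-complete {just b}  ℓ (cell c zero) held with toWitness held
    ... | refl = b , last , fromWitness (slot-last (just b)) , fromWitness (refl , refl)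
    cellMove-complete {nothing} ℓ (cell c zero) ()
    cellMove-complete {h} ℓ (cell c (suc i′)) held =
      c , inject₁ i′ , fromWitness (trans (slot-inject₁ h i′) (toWitness held)) , fromWitness (refl , refl)
    cellMove-complete {just b} ℓ flag raises = b , last , fromWitness (slot-last (just b)) , fromWitness (refl , raises)

    rotate-register : ∀ h f → stepSet Δ ⟦ register (u ∷ʳ h) f ⟧ rotate ≡ ⟦ afterShift rotate u h ⟧
    rotate-register h f = stepSet-⟦⟧ (register (u ∷ʳ h) f) (afterShift rotate u h) rotate sound complete
      where
      sound : ∀ s t → T (register (u ∷ʳ h) f s) → T (transition s rotate t) → T (afterShift rotate u h t)
      sound (cell b i) t = cellMove-sound {h} {f} rotate t
      sound flag       t _ ()
      complete : ∀ t → T (afterShift rotate u h t) → ∃ λ s → T (register (u ∷ʳ h) f s) × T (transition s rotate t)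
      complete t held with cellMove-complete {h} {f} rotate t held
      ... | b , i , held′ , move = cell b i , held′ , move

    toggle-register : ∀ h → stepSet Δ ⟦ register (u ∷ʳ h) false ⟧ toggle ≡ ⟦ afterShift toggle u h ⟧
    toggle-register h = stepSet-⟦⟧ (register (u ∷ʳ h) false) (afterShift toggle u h) toggle sound complete
      where
      sound : ∀ s t → T (register (u ∷ʳ h) false s) → T (transition s toggle t) → T (afterShift toggle u h t)
      sound (cell b i) t = cellMove-sound {h} {false} toggle t
      complete : ∀ t → T (afterShift toggle u h t) → ∃ λ s → T (register (u ∷ʳ h) false s) × T (transition s toggle t)
      complete t held with cellMove-complete {h} {false} toggle t held
      ... | b , i , held′ , move = cell b i , held′ , move

  stepSet-saturates : ∀ P {s} ℓ → T (P s) → (∀ t → T (transition s ℓ t)) → stepSet Δ ⟦ P ⟧ ℓ ≡ ⊤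
  stepSet-saturates P ℓ Ps all =
    trans (stepSet-⟦⟧ P (const true) ℓ (λ _ _ _ _ → _) (λ t _ → _ , Ps , all t)) ⟦const-true⟧

  reset-survivor : ∀ P {s} → T (P s) → T (survives s) → stepSet Δ ⟦ P ⟧ reset ≡ ⟦ initial ⟧
  reset-survivor P {s} Ps alive = stepSet-⟦⟧ P initial reset
    (λ _ _ _ r → proj₂ (Equivalence.to T-∧ r))
    (λ t it → s , Ps , Equivalence.from T-∧ (alive , it))

  reset-no-survivor : ∀ P → (∀ s → T (P s) → ¬ T (survives s)) → stepSet Δ ⟦ P ⟧ reset ≡ ⊥
  reset-no-survivor P none = trans
    (stepSet-⟦⟧ P (const false) reset (λ s _ Ps r → none s Ps (proj₁ (Equivalence.to T-∧ r))) (λ _ ()))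
    ⟦const-false⟧

  survives-last : ∀ b → T (survives (cell b last))
  survives-last b = Equivalence.from (T-∨ {b}) (inj₂ (fromWitness refl))

  length-layout : ∀ lo hi → length (layout lo hi) ≡ length lo + suc (length hi)
  length-layout lo hi = trans (length-++ (map just lo))
    (cong₂ _+_ (length-map just lo) (cong suc (trans (length-map just (reverse hi)) (length-reverse hi))))

  layout-∷ : ∀ lo h hi → layout lo (h ∷ hi) ≡ layout lo hi ∷ʳ just h
  layout-∷ lo h hi = begin
    map just lo ++ nothing ∷ map just (reverse (h ∷ hi))       ≡⟨ cong (λ xs → map just lo ++ nothing ∷ map just xs) (unfold-reverse h hi) ⟩
    map just lo ++ nothing ∷ map just (reverse hi ∷ʳ h)        ≡⟨ cong (λ xs → map just lo ++ nothing ∷ xs) (map-++ just (reverse hi) [ h ]) ⟩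
    map just lo ++ (nothing ∷ map just (reverse hi)) ∷ʳ just h ≡⟨ ++-assoc (map just lo) _ [ just h ] ⟨
    layout lo hi ∷ʳ just h                                     ∎
    where open ≡-Reasoning

  length-gap : ∀ lo → length lo + 0 ≡ k → length (map (just {A = Bool}) lo) ≡ k
  length-gap lo e = trans (length-map just lo) (trans (sym (+-identityʳ (length lo))) e)

  module _ (f : Bool) (lo : List Bool) where

    rotate-head : ∀ h hi → length lo + suc (length hi) ≡ k →
                  stepSet Δ ⟦ register (layout lo (h ∷ hi)) f ⟧ rotate ≡ ⟦ register (layout (h ∷ lo) hi) true ⟧
    rotate-head h hi e = trans (cong (λ u → stepSet Δ ⟦ register u f ⟧ rotate) (layout-∷ lo h hi))
                               (rotate-register (layout lo hi) (trans (length-layout lo hi) e) (just h) f)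

    rotate-gap : length lo + 0 ≡ k → stepSet Δ ⟦ register (layout lo []) f ⟧ rotate ≡ ⟪ borrowing 0 (reverse lo) ⟫
    rotate-gap e = trans (rotate-register (map just lo) (length-gap lo e) nothing f)
                         (cong (λ xs → ⟦ register (nothing ∷ map just xs) false ⟧) (sym (reverse-involutive lo)))

    head-held : ∀ h hi → length lo + suc (length hi) ≡ k → T (register (layout lo (h ∷ hi)) f (cell h last))
    head-held h hi e = fromWitness
      (trans (cong (λ u → slot u (toℕ last)) (layout-∷ lo h hi)) (slot-last (layout lo hi) (trans (length-layout lo hi) e) (just h)))

  toggle-head : ∀ lo h hi → length lo + suc (length hi) ≡ k →
                stepSet Δ ⟦ register (layout lo (h ∷ hi)) false ⟧ toggle ≡ ⟦ register (layout (not h ∷ lo) hi) h ⟧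
  toggle-head lo h hi e = trans (cong (λ u → stepSet Δ ⟦ register u false ⟧ toggle) (layout-∷ lo h hi))
                                (toggle-register (layout lo hi) (trans (length-layout lo hi) e) (just h))

  toggle-gap : ∀ lo → length lo + 0 ≡ k → stepSet Δ ⟦ register (layout lo []) false ⟧ toggle ≡ ⟪ borrowing 0 (reverse lo) ⟫
  toggle-gap lo e = trans (toggle-register (map just lo) (length-gap lo e) nothing)
                          (cong (λ xs → ⟦ register (nothing ∷ map just xs) false ⟧) (sym (reverse-involutive lo)))

  reset-gap : ∀ lo → length lo + 0 ≡ k → stepSet Δ ⟪ settled lo [] ⟫ reset ≡ ⟪ next (settled lo []) reset ⟫
  reset-gap lo e with or lo in some-one
  ... | false = reset-no-survivor (register (layout lo []) true) no-survivor
    where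
    no-survivor : ∀ s → T (register (layout lo []) true s) → ¬ T (survives s)
    no-survivor (cell true i)  held _ = slot-¬or lo some-one (toℕ i) (toWitness held)
    no-survivor (cell false i) held alive with toWitness alive
    ... | refl with trans (sym (slot-last (map just lo) (length-gap lo e) nothing)) (toWitness held)
    ...   | ()
  ... | true with slot-or lo [ nothing ] some-one
  ...   | n , n< , held = reset-survivor (register (layout lo []) true) {cell true (fromℕ< n<1+k)}
                            (fromWitness (trans (cong (slot (layout lo [])) (toℕ-fromℕ< n<1+k)) held)) _
    where
    n<1+k : n < suc k
    n<1+k = m<n⇒m<1+n (subst (n <_) (trans (sym (+-identityʳ _)) e) n<)

  borrowing-survivor : ∀ {j hi} → Sized (borrowing j hi) →
                       ∃ λ s → T (register (layout (ones j) hi) false s) × T (survives s)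
  borrowing-survivor {j} {h ∷ hi} (borrowing e) = cell h last , head-held false (ones j) h hi (sized-ones j e) , survives-last h
  borrowing-survivor {zero}  {[]} (borrowing e) = ⊥-elim (≢-nonZero⁻¹ k (sym e))
  borrowing-survivor {suc j} {[]} (borrowing e) = cell true zero , _ , _

  simulation-full : ∀ ℓ → stepSet Δ ⟦ const true ⟧ ℓ ≡ ⟪ next full ℓ ⟫
  simulation-full rotate = stepSet-saturates (const true) {hub} rotate _ (λ _ → _)
  simulation-full toggle = stepSet-saturates (const true) {hub} toggle _ (λ _ → _)
  simulation-full reset  = reset-survivor (const true) {hub} _ _

  simulation : ∀ {c} ℓ → Sized c → stepSet Δ ⟪ c ⟫ ℓ ≡ ⟪ next c ℓ ⟫
  simulation ℓ full  = trans (cong (λ S → stepSet Δ S ℓ) (sym ⟦const-true⟧)) (simulation-full ℓ)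
  simulation ℓ empty = stepSet-⊥ Δ ℓ
  simulation {settled lo hi}       toggle (settled _) = stepSet-saturates (register (layout lo hi) true) {flag} toggle _ (λ _ → _)
  simulation {settled lo (h ∷ hi)} rotate (settled e) = rotate-head true lo h hi e
  simulation {settled lo []}       rotate (settled e) = rotate-gap true lo e
  simulation {settled lo (h ∷ hi)} reset  (settled e) =
    reset-survivor (register (layout lo (h ∷ hi)) true) (head-held true lo h hi e) (survives-last h)
  simulation {settled lo []}       reset  (settled e) = reset-gap lo e
  simulation {borrowing j hi} reset s@(borrowing _) with borrowing-survivor s
  ... | s′ , held , alive = reset-survivor (register (layout (ones j) hi) false) {s′} held alive
  simulation {borrowing j (h ∷ hi)}     rotate (borrowing e) = rotate-head false (ones j) h hi (sized-ones j e)
  simulation {borrowing j []}           rotate (borrowing e) = rotate-gap false (ones j) (sized-ones j e)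
  simulation {borrowing j (false ∷ hi)} toggle (borrowing e) = toggle-head (ones j) false hi (sized-ones j e)
  simulation {borrowing j (true ∷ hi)}  toggle (borrowing e) = toggle-head (ones j) true hi (sized-ones j e)
  simulation {borrowing j []}           toggle (borrowing e) = toggle-gap (ones j) (sized-ones j e)

  ⟪⟫-run : ∀ {c} w → Sized c → ⟪ c ⟫ ·[ Δ ] w ≡ ⟪ run c w ⟫
  ⟪⟫-run []      _ = refl
  ⟪⟫-run (ℓ ∷ w) s = trans (cong (_·[ Δ ] w) (simulation ℓ s)) (⟪⟫-run w (next-sized ℓ s))

  ⟪⟫≡⊥⇒empty : ∀ {c} → Sized c → ⟪ c ⟫ ≡ ⊥ → c ≡ empty
  ⟪⟫≡⊥⇒empty full ⊤≡⊥ = ⊥-elim (∉⊥ (subst (zero ∈ˢ_) ⊤≡⊥ ∈⊤))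
  ⟪⟫≡⊥⇒empty empty _ = refl
  ⟪⟫≡⊥⇒empty {settled lo hi} (settled _) eq = ⊥-elim (⟦⟧-nonempty (register (layout lo hi) true) {flag} _ eq)
  ⟪⟫≡⊥⇒empty {borrowing j hi} s@(borrowing _) eq with borrowing-survivor s
  ... | s′ , held , _ = ⊥-elim (⟦⟧-nonempty (register (layout (ones j) hi) false) {s′} held eq)

  mortal⇔ : ∀ w → Mortal Δ w ⇔ run full w ≡ empty
  mortal⇔ w = mk⇔
    (λ mortal → ⟪⟫≡⊥⇒empty (run-sized w full) (trans (sym (⟪⟫-run w full)) mortal))
    (λ dies → trans (⟪⟫-run w full) (cong ⟪_⟫ dies))

theorem5 : (m : ℕ) → 3 ≤ m →
    Σ (NFA (2 * m) 3) λ Δ →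
    Σ (Word 3) (λ w → Mortal Δ w) ×
    ((w : Word 3) → Mortal Δ w → 2 ^ (m ∸ 2) ≤ length w)
theorem5 zero ()
theorem5 (suc zero) (s≤s ())
theorem5 (suc (suc zero)) (s≤s (s≤s ()))
theorem5 (suc (suc (suc j))) _ = Δ , mortal , shortest
  where
  open Counter (suc j)
  open CounterNFA (suc j)

  mortal : Σ (Word 3) (Mortal Δ)
  mortal with mortal-from-full
  ... | w , dies = w , Equivalence.from (mortal⇔ w) dies

  shortest : ∀ w → Mortal Δ w → 2 ^ suc j ≤ length w
  shortest w m = potential≤length w full (Equivalence.to (mortal⇔ w) m)
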